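{- Let $S=(w_1,\ldots,w_{3m})$ be a list of positive integers and $b$ an integer. If there is a partition of $\{1,\ldots,3m\}$ into sets $S_1,\ldots,S_m$ with $\sum_{i\in S_j}w_i=b$ for every $j$, then $G(S,b)$ has a path decomposition of width at most $4$ and length at most $l=1-2m+2\sum_{i=1}^{3m}w_i$.
   Context: A path decomposition of a graph $G$ is a sequence $(X_1,\ldots,X_l)$ of subsets of $V(G)$ such that $\bigcup_i X_i=V(G)$; every edge has both endpoints in some $X_i$; and $X_i\cap X_k\subseteq X_j$ whenever $i\leq j\leq k$; width is $\max_i|X_i|-1$, length is $l$. The graph $G(S,b)$ is built as follows. For each $i\in\{1,\ldots,3m\}$, the graph $H_i$ is obtained from pairwise disjoint cliques $K_3^{i,q}$ ($q=1,\ldots,w_i$, copies of $K_3$) and $K_4^{i,q}$ ($q=1,\ldots,w_i-1$, copies of $K_4$) by identifying, for each $q\leq w_i-1$, two different vertices of $K_4^{i,q}$ with a vertex of $K_3^{i,q}$ and a vertex of $K_3^{i,q+1}$ respectively, such that each vertex of each $K_3^{i,q}$ is identified with at most one vertex of another clique (a chain of alternating triangles and $K_4$'s). The graph $H_{m,b}$ is obtained from disjoint copies $K_5^1,\ldots,K_5^{m+1}$ of $K_5$ and disjoint copies $P_b^1,\ldots,P_b^m$ of the path with $b$ edges by identifying, for each $j$, one endpoint of $P_b^j$ with a vertex of $K_5^j$ and the other endpoint with a vertex of $K_5^{j+1}$, so that no vertex of any $K_5^j$ is identified with endpoints of two different paths. $G(S,b)$ is the disjoint union of $H_1,\ldots,H_{3m}$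 and $H_{m,b}$. -}

module Defs where

open import Data.Nat using (ℕ; zero; suc; _+_; _*_; _≤_; _<_)
open import Data.Fin as Fin using (Fin; zero; suc)
open import Data.List using (List; length; map; filter; allFin)
open import Data.Nat.ListAction using (sum)
open import Data.List.Membership.Propositional using (_∈_)
open import Data.List.Relation.Unary.Unique.Propositional using (Unique)
open import Data.Product using (Σ; ∃; ∃-syntax; _×_; _,_)
open import Data.Sum using (_⊎_; inj₁; inj₂)
open import Relation.Binary.PropositionalEquality using (_≡_)
open import Relation.Nullary using (¬_)

record Graph : Set₁ where
  field
    V   : Set
    Adj : V → V → Set

-- A path decomposition (X_1,…,X_l) of length l.  Bags are duplicate-free
-- lists, so |X_i| = length of the list.
record PathDecomposition (G : Graph) (l : ℕ) : Set where
  open Graph G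
  field
    bag        : Fin l → List V
    bag-unique : ∀ i → Unique (bag i)
    covers     : ∀ v → ∃[ i ] (v ∈ bag i)
    edges      : ∀ u v → Adj u v → ∃[ i ] (u ∈ bag i × v ∈ bag i)
    interp     : ∀ i j k → i Fin.≤ j → j Fin.≤ k → ∀ v →
                 v ∈ bag i → v ∈ bag k → v ∈ bag j

-- width = max_i |X_i| - 1 ≤ w   iff   every bag has at most w+1 vertices
WidthAtMost : ∀ {G l} → PathDecomposition G l → ℕ → Set
WidthAtMost P w = ∀ i → length (PathDecomposition.bag P i) ≤ suc w

-- Graphs given as a union of cliques glued at vertices: two distinct
-- vertices are adjacent iff they lie in a common clique.

cliqueAdj : {V C : Set} → (C → V → Set) → V → V → Set
cliqueAdj In u v = ¬ (u ≡ v) × ∃[ c ] (In c u × In c v)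

-- H_i for weight w: triangles T_q (q < w) with vertices tri q _ 0,1,2 and
-- K4's K_q (q+1 < w) with own vertices k4 q _ 0,1; K_q contains
-- vertex 1 of T_q and vertex 0 of T_{q+1}.

data HV (w : ℕ) : Set where
  tri : (q : ℕ) → q < w → Fin 3 → HV w
  k4  : (q : ℕ) → suc q < w → Fin 2 → HV w

data HC (w : ℕ) : Set where
  T : (q : ℕ) → q < w → HC w
  K : (q : ℕ) → suc q < w → HC w

data HIn {w : ℕ} : HC w → HV w → Set where
  inT      : ∀ {q p p' t} → HIn (T q p) (tri q p' t)
  inK-left : ∀ {q p p'} → HIn (K q p) (tri q p' (suc zero))
  inK-right : ∀ {q p p'} → HIn (K q p) (tri (suc q) p' zero)
  inK-own  : ∀ {q p p' s} → HIn (K q p) (k4 q p' s)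

-- H_{m,b}: K5^j (j = 0..m) and paths P^j (j < m) with b edges, path
-- vertex 0 of P^j = vertex 0 of K5^j, path vertex b of P^j = vertex 1 of
-- K5^{j+1}, inner path vertices pint j _ k _ (= path vertex k+1).

data HMV (m b : ℕ) : Set where
  k5   : (j : ℕ) → j ≤ m → Fin 5 → HMV m b
  pint : (j : ℕ) → j < m → (k : ℕ) → suc k < b → HMV m b

data HMC (m b : ℕ) : Set where
  K5  : (j : ℕ) → j ≤ m → HMC m b
  seg : (j : ℕ) → j < m → (e : ℕ) → e < b → HMC m b

data PathVx {m b : ℕ} (j : ℕ) : ℕ → HMV m b → Set where
  start : ∀ {p} → PathVx j 0 (k5 j p zero)
  end   : ∀ {p} → PathVx j b (k5 (suc j) p (suc zero))
  mid   : ∀ {k p q} → PathVx j (suc k) (pint j p k q)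

data HMIn {m b : ℕ} : HMC m b → HMV m b → Set where
  inK5 : ∀ {j p p' s} → HMIn (K5 j p) (k5 j p' s)
  segL : ∀ {j p e q v} → PathVx j e v → HMIn (seg j p e q) v
  segR : ∀ {j p e q v} → PathVx j (suc e) v → HMIn (seg j p e q) v

GV : (m : ℕ) → (Fin (3 * m) → ℕ) → ℕ → Set
GV m S b = (Σ (Fin (3 * m)) (λ i → HV (S i))) ⊎ HMV m b

GC : (m : ℕ) → (Fin (3 * m) → ℕ) → ℕ → Set
GC m S b = (Σ (Fin (3 * m)) (λ i → HC (S i))) ⊎ HMC m b

data GIn {m : ℕ} {S : Fin (3 * m) → ℕ} {b : ℕ} : GC m S b → GV m S b → Set where
  inH  : ∀ {i c v} → HIn c v → GIn (inj₁ (i , c)) (inj₁ (i , v))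
  inHM : ∀ {c v} → HMIn c v → GIn (inj₂ c) (inj₂ v)

G : (m : ℕ) → (Fin (3 * m) → ℕ) → ℕ → Graph
G m S b = record { V = GV m S b ; Adj = cliqueAdj (GIn {m} {S} {b}) }

-- Σ_{i ∈ S_j} w_i, where the partition is given by f : i ↦ index of its part
partSum : ∀ m → (Fin (3 * m) → ℕ) → (Fin (3 * m) → Fin m) → Fin m → ℕ
partSum m S f j = sum (map S (filter (λ i → f i Fin.≟ j) (allFin (3 * m))))

totalWeight : ∀ m → (Fin (3 * m) → ℕ) → ℕ
totalWeight m S = sum (map S (allFin (3 * m)))

-- The bags run through H_{m,b} from left to right: K5^0, the path P^0, K5^1, …, P^{m-1}, K5^m.
-- The part S_j cuts P^j into consecutive stretches, one of w_i edges for each i ∈ S_j; they fill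
-- P^j exactly because Σ_{i ∈ S_j} w_i = b.  A stretch of w_i edges is covered by the 2w_i - 1
-- bags "edge, inner vertex, edge, …", and these are united bag by bag with the bags
-- T_0, K_0, T_1, …, T_{w_i - 1} of the chain H_i, giving bags of 3 + 2 and 4 + 1 vertices;
-- each K5^j is paired with an empty bag.  The length is m + 1 + Σ_i (2w_i - 1) = 1 - 2m + 2Σ_i w_i.
-- Interpolation is verified locally: whatever a bag shares with later bags lies in the next one.

module Submission where

open import Defs
open import Data.Bool using (if_then_else_)
open import Data.Empty using (⊥; ⊥-elim)
open import Data.Fin as Fin using (Fin; zero; suc; toℕ; fromℕ<)
import Data.Fin.Properties as Fin
open import Data.List using (List; []; _∷_; _++_; length; map; filter; lookup; allFin; concatMap; zipWith)
open import Data.List.Properties using (++-identityʳ; length-++; length-map; length-tabulate; map-∘)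
open import Data.List.Membership.Propositional using (_∈_)
open import Data.List.Membership.Propositional.Properties
  using (∈-map⁺; ∈-map⁻; ∈-++⁺ˡ; ∈-++⁺ʳ; ∈-++⁻; ∈-lookup; ∈-allFin; ∈-filter⁻; ∈-filter⁺)
open import Data.List.Relation.Binary.Pointwise using (Pointwise; []; _∷_)
import Data.List.Relation.Binary.Pointwise as Pointwise
open import Data.List.Relation.Unary.All using (All; []; _∷_)
import Data.List.Relation.Unary.All as All
import Data.List.Relation.Unary.All.Properties as All
open import Data.List.Relation.Unary.AllPairs using ([]; _∷_)
open import Data.List.Relation.Unary.Any using (Any; here; there)
import Data.List.Relation.Unary.Any as Any
import Data.List.Relation.Unary.Any.Properties as AnyP
open import Data.List.Relation.Unary.Unique.Propositional using (Unique)
import Data.List.Relation.Unary.Unique.Propositional.Properties as Unique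
open import Data.Nat using (ℕ; zero; suc; pred; _+_; _*_; _≤_; _<_; _<?_; z≤n; s≤s)
open import Data.Nat.ListAction using (sum)
open import Data.Nat.Properties
open import Algebra.Properties.CommutativeSemigroup +-commutativeSemigroup using (interchange; x∙yz≈y∙xz)
open import Data.Product using (Σ; ∃-syntax; _×_; _,_; proj₁; proj₂)
open import Data.Sum using (_⊎_; inj₁; inj₂)
open import Function using (_∘_; id)
open import Relation.Binary.PropositionalEquality using (_≡_; refl; sym; trans; cong; cong₂; subst; module ≡-Reasoning)
open import Relation.Nullary using (yes; no; does)

module _ {V : Set} where

  infix 4 _⊆ₚ_

  _⊆ₚ_ : (V → Set) → List V → Set
  P ⊆ₚ B = ∀ {v} → P v → v ∈ B

  infix 4 _∈∈_

  _∈∈_ : V → List (List V) → Set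
  v ∈∈ Bs = Any (v ∈_) Bs

  firstBag : List (List V) → List V
  firstBag []      = []
  firstBag (B ∷ _) = B

  lastBag : List (List V) → List V
  lastBag []           = []
  lastBag (B ∷ [])     = B
  lastBag (_ ∷ B ∷ Bs) = lastBag (B ∷ Bs)

  data Interpolating : List (List V) → Set where
    []  : Interpolating []
    _∷_ : ∀ {B Bs} → (∀ {v} → v ∈ B → v ∈∈ Bs → v ∈ firstBag Bs) →
          Interpolating Bs → Interpolating (B ∷ Bs)

  lastBag-∈∈ : ∀ {v} B Bs → v ∈ lastBag (B ∷ Bs) → v ∈∈ B ∷ Bs
  lastBag-∈∈ B []        v∈ = here v∈
  lastBag-∈∈ B (B′ ∷ Bs) v∈ = there (lastBag-∈∈ B′ Bs v∈)

  firstBag-++ : ∀ {v} A C → v ∈ firstBag A → v ∈ firstBag (A ++ C)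
  firstBag-++ (B ∷ A) C v∈ = v∈

  lastBag-++ : ∀ {v} A C → v ∈ lastBag C → v ∈ lastBag (A ++ C)
  lastBag-++ []           C        v∈ = v∈
  lastBag-++ (B ∷ [])     (B′ ∷ C) v∈ = v∈
  lastBag-++ (B ∷ B′ ∷ A) C        v∈ = lastBag-++ (B′ ∷ A) C v∈

  interpolating-++ : ∀ A {C} → Interpolating A → Interpolating C →
    (∀ {v} → v ∈∈ A → v ∈∈ C → v ∈ lastBag A × v ∈ firstBag C) →
    Interpolating (A ++ C)
  interpolating-++ []           iA             iC shared = iC
  interpolating-++ (B ∷ [])     (next ∷ _)     iC shared =
    (λ v∈B v∈C → proj₂ (shared (here v∈B) v∈C)) ∷ iC
  interpolating-++ (B ∷ B′ ∷ A) {C} (next ∷ iA) iC shared =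
    next′ ∷ interpolating-++ (B′ ∷ A) iA iC (λ v∈A v∈C → shared (there v∈A) v∈C)
    where
    next′ : ∀ {v} → v ∈ B → v ∈∈ (B′ ∷ A) ++ C → v ∈ B′
    next′ v∈B v∈ with AnyP.++⁻ (B′ ∷ A) v∈
    ... | inj₁ v∈A = next v∈B v∈A
    ... | inj₂ v∈C = next v∈B (lastBag-∈∈ B′ A (proj₁ (shared (here v∈B) v∈C)))

  interpolating-++-disjoint : ∀ A {C} → Interpolating A → Interpolating C →
    (∀ {v} → v ∈∈ A → v ∈∈ C → ⊥) → Interpolating (A ++ C)
  interpolating-++-disjoint A iA iC disjoint =
    interpolating-++ A iA iC (λ v∈A v∈C → ⊥-elim (disjoint v∈A v∈C))

  lookup-∈∈ : ∀ {v} (L : List (List V)) (i : Fin (length L)) → v ∈ lookup L i → v ∈∈ L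
  lookup-∈∈ (B ∷ L) zero    v∈ = here v∈
  lookup-∈∈ (B ∷ L) (suc i) v∈ = there (lookup-∈∈ L i v∈)

  interpolating-lookup : ∀ {L} → Interpolating L → ∀ (i j k : Fin (length L)) →
    i Fin.≤ j → j Fin.≤ k → ∀ v → v ∈ lookup L i → v ∈ lookup L k → v ∈ lookup L j
  interpolating-lookup (next ∷ iL) zero zero k i≤j j≤k v v∈i v∈k = v∈i
  interpolating-lookup {B ∷ B′ ∷ L} (next ∷ iL) zero (suc j) (suc k) i≤j (s≤s j≤k) v v∈i v∈k =
    interpolating-lookup iL zero j k z≤n j≤k v (next v∈i (lookup-∈∈ (B′ ∷ L) k v∈k)) v∈k
  interpolating-lookup (next ∷ iL) (suc i) (suc j) (suc k) (s≤s i≤j) (s≤s j≤k) v v∈i v∈k =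
    interpolating-lookup iL i j k i≤j j≤k v v∈i v∈k

module _ {U V : Set} {h : U → V} where

  ∈∈-map⁻ : ∀ {v} L → v ∈∈ map (map h) L → ∃[ u ] (u ∈∈ L × v ≡ h u)
  ∈∈-map⁻ (B ∷ L) (here v∈) with ∈-map⁻ h v∈
  ... | u , u∈ , refl = u , here u∈ , refl
  ∈∈-map⁻ (B ∷ L) (there v∈) with ∈∈-map⁻ L v∈
  ... | u , u∈ , refl = u , there u∈ , refl

  firstBag-map : ∀ {u} L → u ∈ firstBag L → h u ∈ firstBag (map (map h) L)
  firstBag-map (B ∷ L) u∈ = ∈-map⁺ h u∈

  interpolating-map : (∀ {x y} → h x ≡ h y → x ≡ y) →
    ∀ {L} → Interpolating L → Interpolating (map (map h) L)
  interpolating-map h-injective []                    = []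
  interpolating-map h-injective {B ∷ L} (next ∷ iL) = next′ ∷ interpolating-map h-injective iL
    where
    next′ : ∀ {v} → v ∈ map h B → v ∈∈ map (map h) L → v ∈ firstBag (map (map h) L)
    next′ v∈B v∈L with ∈-map⁻ h v∈B | ∈∈-map⁻ L v∈L
    next′ {v} v∈B v∈L | u , u∈B , refl | u′ , u′∈L , hu≡hu′ with h-injective hu≡hu′
    ... | refl = firstBag-map L (next u∈B u′∈L)

Fits : ∀ {A B : Set} → ℕ → List A → List B → Set
Fits n X Y = Unique X × Unique Y × length X + length Y ≤ n

fits-map : ∀ {A A′ B : Set} {h : A → A′} {n} → (∀ {x y} → h x ≡ h y → x ≡ y) →
  ∀ {Xs Ys} → Pointwise (Fits {B = B} n) Xs Ys → Pointwise (Fits n) (map (map h) Xs) Ys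
fits-map h-injective []                                = []
fits-map {h = h} h-injective {X ∷ _} ((uX , uY , le) ∷ pw) =
  (Unique.map⁺ h-injective uX , uY , subst (λ k → k + _ ≤ _) (sym (length-map h X)) le) ∷ fits-map h-injective pw

module _ {A B : Set} where

  infixr 5 _⊎ᵇ_

  _⊎ᵇ_ : List A → List B → List (A ⊎ B)
  X ⊎ᵇ Y = map inj₁ X ++ map inj₂ Y

  inj₁-∈-⊎ᵇ : ∀ {a} X Y → inj₁ a ∈ X ⊎ᵇ Y → a ∈ X
  inj₁-∈-⊎ᵇ X Y a∈ with ∈-++⁻ (map inj₁ X) a∈
  ... | inj₁ a∈X with ∈-map⁻ inj₁ a∈X
  ...   | _ , a∈X′ , refl = a∈X′
  inj₁-∈-⊎ᵇ X Y a∈ | inj₂ a∈Y with ∈-map⁻ inj₂ a∈Y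
  ...   | _ , _ , ()

  inj₂-∈-⊎ᵇ : ∀ {b} X Y → inj₂ b ∈ X ⊎ᵇ Y → b ∈ Y
  inj₂-∈-⊎ᵇ X Y b∈ with ∈-++⁻ (map inj₁ X) b∈
  ... | inj₂ b∈Y with ∈-map⁻ inj₂ b∈Y
  ...   | _ , b∈Y′ , refl = b∈Y′
  inj₂-∈-⊎ᵇ X Y b∈ | inj₁ b∈X with ∈-map⁻ inj₁ b∈X
  ...   | _ , _ , ()

  ∈-⊎ᵇ-inj₁ : ∀ {a} X Y → a ∈ X → inj₁ a ∈ X ⊎ᵇ Y
  ∈-⊎ᵇ-inj₁ X Y a∈ = ∈-++⁺ˡ (∈-map⁺ inj₁ a∈)

  ∈-⊎ᵇ-inj₂ : ∀ {b} X Y → b ∈ Y → inj₂ b ∈ X ⊎ᵇ Y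
  ∈-⊎ᵇ-inj₂ X Y b∈ = ∈-++⁺ʳ (map inj₁ X) (∈-map⁺ inj₂ b∈)

  unique-⊎ᵇ : ∀ {X Y} → Unique X → Unique Y → Unique (X ⊎ᵇ Y)
  unique-⊎ᵇ {X} {Y} uX uY =
    Unique.++⁺ (Unique.map⁺ (λ { refl → refl }) uX) (Unique.map⁺ (λ { refl → refl }) uY) disjoint
    where
    disjoint : ∀ {v} → v ∈ map inj₁ X × v ∈ map inj₂ Y → ⊥
    disjoint (v∈X , v∈Y) with ∈-map⁻ inj₁ v∈X | ∈-map⁻ inj₂ v∈Y
    ... | _ , _ , refl | _ , _ , ()

  length-⊎ᵇ : ∀ X Y → length (X ⊎ᵇ Y) ≡ length X + length Y
  length-⊎ᵇ X Y = trans (length-++ (map inj₁ X)) (cong₂ _+_ (length-map inj₁ X) (length-map inj₂ Y))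

  module _ {R : List A → List B → Set} where

    inj₁-∈∈-zip : ∀ {a Xs Ys} → Pointwise R Xs Ys → inj₁ a ∈∈ zipWith _⊎ᵇ_ Xs Ys → a ∈∈ Xs
    inj₁-∈∈-zip {Xs = X ∷ _} {Y ∷ _} (_ ∷ _)  (here a∈)  = here (inj₁-∈-⊎ᵇ X Y a∈)
    inj₁-∈∈-zip                     (_ ∷ pw) (there a∈) = there (inj₁-∈∈-zip pw a∈)

    inj₂-∈∈-zip : ∀ {b Xs Ys} → Pointwise R Xs Ys → inj₂ b ∈∈ zipWith _⊎ᵇ_ Xs Ys → b ∈∈ Ys
    inj₂-∈∈-zip {Xs = X ∷ _} {Y ∷ _} (_ ∷ _)  (here b∈)  = here (inj₂-∈-⊎ᵇ X Y b∈)
    inj₂-∈∈-zip                     (_ ∷ pw) (there b∈) = there (inj₂-∈∈-zip pw b∈)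

    firstBag-zip-inj₁ : ∀ {a Xs Ys} → Pointwise R Xs Ys → a ∈ firstBag Xs →
      inj₁ a ∈ firstBag (zipWith _⊎ᵇ_ Xs Ys)
    firstBag-zip-inj₁ {Xs = X ∷ _} {Y ∷ _} (_ ∷ _) a∈ = ∈-⊎ᵇ-inj₁ X Y a∈

    firstBag-zip-inj₂ : ∀ {b Xs Ys} → Pointwise R Xs Ys → b ∈ firstBag Ys →
      inj₂ b ∈ firstBag (zipWith _⊎ᵇ_ Xs Ys)
    firstBag-zip-inj₂ {Xs = X ∷ _} {Y ∷ _} (_ ∷ _) b∈ = ∈-⊎ᵇ-inj₂ X Y b∈

    interpolating-zip : ∀ {Xs Ys} → Pointwise R Xs Ys →
      Interpolating Xs → Interpolating Ys → Interpolating (zipWith _⊎ᵇ_ Xs Ys)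
    interpolating-zip [] [] [] = []
    interpolating-zip {X ∷ Xs} {Y ∷ Ys} (_ ∷ pw) (nextX ∷ iX) (nextY ∷ iY) =
      next ∷ interpolating-zip pw iX iY
      where
      next : ∀ {v} → v ∈ X ⊎ᵇ Y → v ∈∈ zipWith _⊎ᵇ_ Xs Ys → v ∈ firstBag (zipWith _⊎ᵇ_ Xs Ys)
      next {inj₁ a} v∈ v∈′ = firstBag-zip-inj₁ pw (nextX (inj₁-∈-⊎ᵇ X Y v∈) (inj₁-∈∈-zip pw v∈′))
      next {inj₂ b} v∈ v∈′ = firstBag-zip-inj₂ pw (nextY (inj₂-∈-⊎ᵇ X Y v∈) (inj₂-∈∈-zip pw v∈′))

    any-zip-inj₁ : ∀ {P : A → Set} {Xs Ys} → Pointwise R Xs Ys →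
      Any (P ⊆ₚ_) Xs →
      Any (λ Z → ∀ {a} → P a → inj₁ a ∈ Z) (zipWith _⊎ᵇ_ Xs Ys)
    any-zip-inj₁ {Xs = X ∷ _} {Y ∷ _} (_ ∷ _)  (here P⊆X) = here (λ Pa → ∈-⊎ᵇ-inj₁ X Y (P⊆X Pa))
    any-zip-inj₁                     (_ ∷ pw) (there p)  = there (any-zip-inj₁ pw p)

    any-zip-inj₂ : ∀ {P : B → Set} {Xs Ys} → Pointwise R Xs Ys →
      Any (P ⊆ₚ_) Ys →
      Any (λ Z → ∀ {b} → P b → inj₂ b ∈ Z) (zipWith _⊎ᵇ_ Xs Ys)
    any-zip-inj₂ {Xs = X ∷ _} {Y ∷ _} (_ ∷ _)  (here P⊆Y) = here (λ Pb → ∈-⊎ᵇ-inj₂ X Y (P⊆Y Pb))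
    any-zip-inj₂                     (_ ∷ pw) (there p)  = there (any-zip-inj₂ pw p)

    length-zip : ∀ {Xs Ys} → Pointwise R Xs Ys → length (zipWith _⊎ᵇ_ Xs Ys) ≡ length Ys
    length-zip []       = refl
    length-zip (_ ∷ pw) = cong suc (length-zip pw)

  all-zip : ∀ {n Xs Ys} → Pointwise (Fits n) Xs Ys →
    All (λ Z → Unique Z × length Z ≤ n) (zipWith _⊎ᵇ_ Xs Ys)
  all-zip                     []                    = []
  all-zip {Xs = X ∷ _} {Y ∷ _} ((uX , uY , le) ∷ pw) =
    (unique-⊎ᵇ uX uY , ≤-trans (≤-reflexive (length-⊎ᵇ X Y)) le) ∷ all-zip pw

module _ {I : Set} {F : I → Set} where

  tagged : (i : I) → List (List (F i)) → List (List (Σ I F))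
  tagged i = map (map (i ,_))

  ∈∈-tagged : ∀ {i x} L → x ∈∈ tagged i L → proj₁ x ≡ i
  ∈∈-tagged L x∈ with ∈∈-map⁻ L x∈
  ... | _ , _ , refl = refl

  any-tagged : ∀ {i} {P : F i → Set} {L} → Any (P ⊆ₚ_) L →
    Any ((λ x → ∃[ y ] (x ≡ (i , y) × P y)) ⊆ₚ_) (tagged i L)
  any-tagged {i} = AnyP.map⁺ ∘ Any.map (λ P⊆B → λ { (y , refl , Py) → ∈-map⁺ (i ,_) (P⊆B Py) })

  ∈∈-concat-tagged : ∀ {x} (L : (i : I) → List (List (F i))) {is} →
    x ∈∈ concatMap (λ i → tagged i (L i)) is → proj₁ x ∈ is
  ∈∈-concat-tagged L x∈ = Any.map (λ {i} → ∈∈-tagged (L i)) (AnyP.concatMap⁻ (λ i → tagged i (L i)) x∈)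

  -- The injectivity of (i ,_) uses K.
  interpolating-concat-tagged : (L : (i : I) → List (List (F i))) → (∀ i → Interpolating (L i)) →
    ∀ {is} → Unique is → Interpolating (concatMap (λ i → tagged i (L i)) is)
  interpolating-concat-tagged L iL {[]}     _          = []
  interpolating-concat-tagged L iL {i ∷ is} (i∉ ∷ uis) =
    interpolating-++-disjoint (tagged i (L i))
      (interpolating-map (λ { refl → refl }) (iL i))
      (interpolating-concat-tagged L iL uis)
      disjoint
    where
    disjoint : ∀ {x} → x ∈∈ tagged i (L i) → x ∈∈ concatMap (λ i → tagged i (L i)) is → ⊥
    disjoint x∈ x∈′ = All.lookup i∉ (subst (_∈ is) (∈∈-tagged (L i) x∈) (∈∈-concat-tagged L x∈′)) refl

module _ {V C : Set} (In : C → V → Set) where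

  cliqueDecomposition : ∀ w (L : List (List V)) → Interpolating L →
    All (λ B → Unique B × length B ≤ suc w) L →
    (∀ v → ∃[ c ] In c v) → (∀ c → Any (In c ⊆ₚ_) L) →
    Σ (PathDecomposition (record { V = V ; Adj = cliqueAdj In }) (length L))
      (λ P → WidthAtMost P w)
  cliqueDecomposition w L iL bags home contained = P , λ i → proj₂ (bag-ok i)
    where
    bag-ok : ∀ i → Unique (lookup L i) × length (lookup L i) ≤ suc w
    bag-ok i = All.lookup bags (∈-lookup i)

    P : PathDecomposition _ (length L)
    P = record
      { bag        = lookup L
      ; bag-unique = λ i → proj₁ (bag-ok i)
      ; covers     = λ v → let c , v∈c = home v ; c∈ = contained c in
                       Any.index c∈ , AnyP.lookup-index c∈ v∈c
      ; edges      = λ u v (_ , c , u∈c , v∈c) → let c∈ = contained c in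
                       Any.index c∈ , AnyP.lookup-index c∈ u∈c , AnyP.lookup-index c∈ v∈c
      ; interp     = interpolating-lookup iL
      }

+suc⇒< : ∀ {q r w} → q + suc r ≡ w → q < w
+suc⇒< {q} eq = subst (q <_) eq (m<m+n q (s≤s z≤n))

+suc-shift : ∀ {q r w} → q + suc r ≡ w → suc q + r ≡ w
+suc-shift {q} {r} eq = trans (sym (+-suc q r)) eq

range-empty : ∀ {q q₀} → q₀ ≤ q → q < q₀ + 0 → ⊥
range-empty {q₀ = q₀} q₀≤q q<q₀ = ≤⇒≯ q₀≤q (subst (_ <_) (+-identityʳ q₀) q<q₀)

range-step : ∀ {q q₀ r} → q₀ ≤ q → q < q₀ + suc r → q ≡ q₀ ⊎ (suc q₀ ≤ q × q < suc q₀ + r)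
range-step {q} {q₀} {r} q₀≤q q<q₀+1+r with m≤n⇒m<n∨m≡n q₀≤q
... | inj₂ refl = inj₁ refl
... | inj₁ q₀<q = inj₂ (q₀<q , subst (q <_) (+-suc q₀ r) q<q₀+1+r)

module _ {m : ℕ} where

  sumFrom : (Fin m → ℕ) → (j r : ℕ) → j + r ≡ m → ℕ
  sumFrom g j zero    _  = 0
  sumFrom g j (suc r) eq = g (fromℕ< (+suc⇒< eq)) + sumFrom g (suc j) r (+suc-shift eq)

  sumFrom-cong : ∀ {g g′} → (∀ J → g J ≡ g′ J) → ∀ j r eq → sumFrom g j r eq ≡ sumFrom g′ j r eq
  sumFrom-cong g≗g′ j zero    eq = refl
  sumFrom-cong g≗g′ j (suc r) eq = cong₂ _+_ (g≗g′ _) (sumFrom-cong g≗g′ (suc j) r _)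

  sumFrom-+ : ∀ g g′ j r eq → sumFrom (λ J → g J + g′ J) j r eq ≡ sumFrom g j r eq + sumFrom g′ j r eq
  sumFrom-+ g g′ j zero    eq = refl
  sumFrom-+ g g′ j (suc r) eq = trans (cong (g J + g′ J +_) (sumFrom-+ g g′ (suc j) r _))
                                      (interchange (g J) (g′ J) _ _)
    where
    J : Fin m
    J = fromℕ< (+suc⇒< eq)

  indicator : Fin m → ℕ → Fin m → ℕ
  indicator J₀ c J = if does (J₀ Fin.≟ J) then c else 0

  sumFrom-indicator-below : ∀ J₀ c j r eq → toℕ J₀ < j → sumFrom (indicator J₀ c) j r eq ≡ 0
  sumFrom-indicator-below J₀ c j zero    eq J₀<j = refl
  sumFrom-indicator-below J₀ c j (suc r) eq J₀<j with J₀ Fin.≟ fromℕ< (+suc⇒< eq)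
  ... | yes refl = ⊥-elim (<-irrefl (Fin.toℕ-fromℕ< _) J₀<j)
  ... | no  _    = sumFrom-indicator-below J₀ c (suc j) r _ (≤-trans J₀<j (n≤1+n j))

  sumFrom-indicator : ∀ J₀ c j r eq → j ≤ toℕ J₀ → sumFrom (indicator J₀ c) j r eq ≡ c
  sumFrom-indicator J₀ c j zero    eq j≤J₀ =
    ⊥-elim (≤⇒≯ j≤J₀ (subst (toℕ J₀ <_) (trans (sym eq) (+-identityʳ j)) (Fin.toℕ<n J₀)))
  sumFrom-indicator J₀ c j (suc r) eq j≤J₀ with J₀ Fin.≟ fromℕ< (+suc⇒< eq)
  ... | yes refl = trans (cong (c +_) (sumFrom-indicator-below J₀ c (suc j) r _ J₀<1+j)) (+-identityʳ c)
    where
    J₀<1+j : toℕ J₀ < suc j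
    J₀<1+j = s≤s (≤-reflexive (Fin.toℕ-fromℕ< _))
  ... | no  J₀≢j = sumFrom-indicator J₀ c (suc j) r _ (≤∧≢⇒< j≤J₀ j≢J₀)
    where
    j≢J₀ : j ≡ toℕ J₀ → ⊥
    j≢J₀ j≡J₀ = J₀≢j (Fin.toℕ-injective (trans (sym j≡J₀) (sym (Fin.toℕ-fromℕ< _))))

  sumFrom-zero : ∀ j r eq → sumFrom (λ _ → 0) j r eq ≡ 0
  sumFrom-zero j zero    eq = refl
  sumFrom-zero j (suc r) eq = sumFrom-zero (suc j) r _

  module _ {A : Set} (f : A → Fin m) (h : A → ℕ) where

    fibreSum : List A → Fin m → ℕ
    fibreSum xs J = sum (map h (filter (λ x → f x Fin.≟ J) xs))

    fibreSum-∷ : ∀ x xs J → fibreSum (x ∷ xs) J ≡ indicator (f x) (h x) J + fibreSum xs J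
    fibreSum-∷ x xs J with f x Fin.≟ J
    ... | yes _ = refl
    ... | no  _ = refl

    sumFrom-fibreSum : ∀ xs → sumFrom (fibreSum xs) 0 m refl ≡ sum (map h xs)
    sumFrom-fibreSum []       = sumFrom-zero 0 m refl
    sumFrom-fibreSum (x ∷ xs) = begin
      sumFrom (fibreSum (x ∷ xs)) 0 m refl
        ≡⟨ sumFrom-cong (fibreSum-∷ x xs) 0 m refl ⟩
      sumFrom (λ J → indicator (f x) (h x) J + fibreSum xs J) 0 m refl
        ≡⟨ sumFrom-+ (indicator (f x) (h x)) (fibreSum xs) 0 m refl ⟩
      sumFrom (indicator (f x) (h x)) 0 m refl + sumFrom (fibreSum xs) 0 m refl
        ≡⟨ cong₂ _+_ (sumFrom-indicator (f x) (h x) 0 m refl z≤n) (sumFrom-fibreSum xs) ⟩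
      h x + sum (map h xs) ∎
      where open ≡-Reasoning

module _ {w : ℕ} where

  level : HV w → ℕ
  level (tri q _ _) = q
  level (k4 q _ _)  = q

  triangleBag : ∀ q → q < w → List (HV w)
  triangleBag q p = map (tri q p) (allFin 3)

  k4Bag : ∀ q → q < w → suc q < w → List (HV w)
  k4Bag q p p′ = tri q p (suc zero) ∷ tri (suc q) p′ zero ∷ k4 q p′ zero ∷ k4 q p′ (suc zero) ∷ []

  chainFrom : ∀ q r → q + suc r ≡ w → List (List (HV w))
  chainFrom q zero    eq = triangleBag q (+suc⇒< eq) ∷ []
  chainFrom q (suc r) eq = triangleBag q (+suc⇒< eq) ∷ k4Bag q (+suc⇒< eq) (+suc⇒< (+suc-shift eq))
                         ∷ chainFrom (suc q) r (+suc-shift eq)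

  triangleBag-level : ∀ {q p x} → x ∈ triangleBag q p → level x ≡ q
  triangleBag-level {q} {p} x∈ with ∈-map⁻ (tri q p) x∈
  ... | _ , _ , refl = refl

  k4Bag-level : ∀ {q p p′ x} → x ∈ k4Bag q p p′ → q ≤ level x
  k4Bag-level (here refl)                      = ≤-refl
  k4Bag-level (there (here refl))              = n≤1+n _
  k4Bag-level (there (there (here refl)))      = ≤-refl
  k4Bag-level (there (there (there (here refl)))) = ≤-refl

  chainFrom-level : ∀ {q r eq x} → x ∈∈ chainFrom q r eq → q ≤ level x
  chainFrom-level {r = zero}  (here x∈)                 = ≤-reflexive (sym (triangleBag-level x∈))
  chainFrom-level {r = suc r} (here x∈)                 = ≤-reflexive (sym (triangleBag-level x∈))
  chainFrom-level {r = suc r} (there (here x∈))         = k4Bag-level x∈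
  chainFrom-level {r = suc r} (there (there x∈))        = ≤-trans (n≤1+n _) (chainFrom-level x∈)

  tri-∈-triangleBag : ∀ {q p p′ t} → tri q p′ t ∈ triangleBag q p
  tri-∈-triangleBag {q} {p} {p′} {t} with <-irrelevant p′ p
  ... | refl = ∈-map⁺ (tri q p) (∈-allFin t)

  tri-∈-firstBag-chainFrom : ∀ q r eq → tri q (+suc⇒< eq) zero ∈ firstBag (chainFrom q r eq)
  tri-∈-firstBag-chainFrom q zero    eq = tri-∈-triangleBag
  tri-∈-firstBag-chainFrom q (suc r) eq = tri-∈-triangleBag

  interpolating-chainFrom : ∀ q r eq → Interpolating (chainFrom q r eq)
  interpolating-chainFrom q zero    eq = (λ _ ()) ∷ []
  interpolating-chainFrom q (suc r) eq =
    triangle-next ∷ k4-next ∷ interpolating-chainFrom (suc q) r (+suc-shift eq)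
    where
    p : q < w
    p = +suc⇒< eq
    p′ : suc q < w
    p′ = +suc⇒< (+suc-shift eq)
    rest : List (List (HV w))
    rest = chainFrom (suc q) r (+suc-shift eq)
    triangle-next : ∀ {x} → x ∈ triangleBag q p → x ∈∈ k4Bag q p p′ ∷ rest → x ∈ k4Bag q p p′
    triangle-next x∈ (here x∈′)  = x∈′
    triangle-next x∈ (there x∈′) = ⊥-elim (<-irrefl (sym (triangleBag-level x∈)) (chainFrom-level x∈′))
    k4-next : ∀ {x} → x ∈ k4Bag q p p′ → x ∈∈ rest → x ∈ firstBag rest
    k4-next (here refl)                         x∈′ = ⊥-elim (<-irrefl refl (chainFrom-level x∈′))
    k4-next (there (here refl))                 x∈′ = tri-∈-firstBag-chainFrom (suc q) r _
    k4-next (there (there (here refl)))         x∈′ = ⊥-elim (<-irrefl refl (chainFrom-level x∈′))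
    k4-next (there (there (there (here refl)))) x∈′ = ⊥-elim (<-irrefl refl (chainFrom-level x∈′))

  triangleBag-unique : ∀ q p → Unique (triangleBag q p)
  triangleBag-unique q p = Unique.map⁺ {f = tri q p} (λ { refl → refl }) (Unique.allFin⁺ 3)

  k4Bag-unique : ∀ q p p′ → Unique (k4Bag q p p′)
  k4Bag-unique q p p′ =
    ((λ ()) ∷ (λ ()) ∷ (λ ()) ∷ []) ∷ ((λ ()) ∷ (λ ()) ∷ []) ∷ ((λ ()) ∷ []) ∷ [] ∷ []

  k4Bag-contains : ∀ {q p p₁ p₂} → HIn (K q p) ⊆ₚ k4Bag q p₁ p₂
  k4Bag-contains {p₁ = p₁} (inK-left {p' = p′})  rewrite <-irrelevant p′ p₁ = here refl
  k4Bag-contains {p₂ = p₂} (inK-right {p' = p′}) rewrite <-irrelevant p′ p₂ = there (here refl)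
  k4Bag-contains {p₂ = p₂} (inK-own {p' = p′} {s = zero})     rewrite <-irrelevant p′ p₂ =
    there (there (here refl))
  k4Bag-contains {p₂ = p₂} (inK-own {p' = p′} {s = suc zero}) rewrite <-irrelevant p′ p₂ =
    there (there (there (here refl)))

  chainFrom-triangle : ∀ {q p} q₀ r eq → q₀ ≤ q → q < q₀ + suc r →
    Any (HIn (T q p) ⊆ₚ_) (chainFrom q₀ r eq)
  chainFrom-triangle q₀ zero eq q₀≤q q< with range-step q₀≤q q<
  ... | inj₁ refl         = here λ { inT → tri-∈-triangleBag }
  ... | inj₂ (q₀<q , q<′) = ⊥-elim (range-empty q₀<q q<′)
  chainFrom-triangle q₀ (suc r) eq q₀≤q q< with range-step q₀≤q q<
  ... | inj₁ refl         = here λ { inT → tri-∈-triangleBag }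
  ... | inj₂ (q₀<q , q<′) = there (there (chainFrom-triangle (suc q₀) r _ q₀<q q<′))

  chainFrom-k4 : ∀ {q p} q₀ r eq → q₀ ≤ q → q < q₀ + r → Any (HIn (K q p) ⊆ₚ_) (chainFrom q₀ r eq)
  chainFrom-k4 q₀ zero    eq q₀≤q q< = ⊥-elim (range-empty q₀≤q q<)
  chainFrom-k4 q₀ (suc r) eq q₀≤q q< with range-step q₀≤q q<
  ... | inj₁ refl         = there (here k4Bag-contains)
  ... | inj₂ (q₀<q , q<′) = there (there (chainFrom-k4 (suc q₀) r _ q₀<q q<′))

chain : ∀ w → List (List (HV w))
chain zero    = []
chain (suc r) = chainFrom 0 r refl

interpolating-chain : ∀ w → Interpolating (chain w)
interpolating-chain zero    = []
interpolating-chain (suc r) = interpolating-chainFrom 0 r refl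

chain-contains : ∀ {w} (c : HC w) → Any (HIn c ⊆ₚ_) (chain w)
chain-contains {suc r} (T q p) = chainFrom-triangle 0 r refl z≤n p
chain-contains {suc r} (K q p) = chainFrom-k4 0 r refl z≤n (≤-pred p)

module _ {m b : ℕ} where

  block : HMV m b → ℕ
  block (k5 j _ _)     = j
  block (pint j _ _ _) = j

  k5Bag : (j : ℕ) → j ≤ m → List (HMV m b)
  k5Bag j p = map (k5 j p) (allFin 5)

  k5Bag-unique : ∀ j p → Unique (k5Bag j p)
  k5Bag-unique j p = Unique.map⁺ {f = k5 j p} (λ { refl → refl }) (Unique.allFin⁺ 5)

  k5-∈-k5Bag : ∀ {j p p′ s} → k5 j p′ s ∈ k5Bag j p
  k5-∈-k5Bag {j} {p} {p′} {s} with ≤-irrelevant p′ p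
  ... | refl = ∈-map⁺ (k5 j p) (∈-allFin s)

  k5Bag-block : ∀ {j p v} → v ∈ k5Bag j p → block v ≡ j
  k5Bag-block {j} {p} v∈ with ∈-map⁻ (k5 j p) v∈
  ... | _ , _ , refl = refl

  module _ (j : ℕ) (j<m : j < m) where

    -- Vertex k of P^j for k ≤ b (for k > b the value is junk).
    pathVertex : ℕ → HMV m b
    pathVertex zero    = k5 j (<⇒≤ j<m) zero
    pathVertex (suc k) with suc k <? b
    ... | yes k<b = pint j j<m k k<b
    ... | no  _   = k5 (suc j) j<m (suc zero)

    pathVertex-PathVx : ∀ {k} → k ≤ b → PathVx j k (pathVertex k)
    pathVertex-PathVx {zero}  _   = start
    pathVertex-PathVx {suc k} k≤b with suc k <? b
    ... | yes _   = mid
    ... | no  k≮b rewrite ≤-antisym k≤b (≮⇒≥ k≮b) = end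

    PathVx-functional : ∀ {k k′ v} → PathVx {m} {b} j k v → PathVx j k′ v → k ≡ k′
    PathVx-functional start start = refl
    PathVx-functional end   end   = refl
    PathVx-functional mid   mid   = refl

    pathVertex-injective : ∀ {k k′} → k ≤ b → k′ ≤ b → pathVertex k ≡ pathVertex k′ → k ≡ k′
    pathVertex-injective {k} {k′} k≤b k′≤b eq =
      PathVx-functional (pathVertex-PathVx k≤b) (subst (PathVx j k′) (sym eq) (pathVertex-PathVx k′≤b))

    -- 0 < b is needed: for b = 0 both endpoints of P^j satisfy PathVx j 0.
    PathVx⇒pathVertex : ∀ {k v} → 0 < b → PathVx j k v → v ≡ pathVertex k
    PathVx⇒pathVertex _ (start {p}) = cong (λ p → k5 j p zero) (≤-irrelevant p _)
    PathVx⇒pathVertex (s≤s _) (end {p}) with b <? b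
    ... | yes b<b = ⊥-elim (<-irrefl refl b<b)
    ... | no  _   = cong (λ p → k5 (suc j) p (suc zero)) (≤-irrelevant p _)
    PathVx⇒pathVertex _ (mid {k} {p} {q}) with suc k <? b
    ... | yes q′ = cong₂ (λ p q → pint j p k q) (<-irrelevant p _) (<-irrelevant q q′)
    ... | no q≮ = ⊥-elim (q≮ q)

    pathVertex-block : ∀ k → j ≤ block (pathVertex k)
    pathVertex-block zero = ≤-refl
    pathVertex-block (suc k) with suc k <? b
    ... | yes _ = ≤-refl
    ... | no  _ = n≤1+n j

    pathVertex-beyond : ∀ k → k ≤ b → suc j ≤ block (pathVertex k) →
      k ≡ b × (∀ {p} → pathVertex k ∈ k5Bag (suc j) p)
    pathVertex-beyond zero    _   j<j = ⊥-elim (<-irrefl refl j<j)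
    pathVertex-beyond (suc k) k≤b j< with suc k <? b
    ... | yes _   = ⊥-elim (<-irrefl refl j<)
    ... | no  k≮b = ≤-antisym k≤b (≮⇒≥ k≮b) , k5-∈-k5Bag

    pathVertex-k5 : ∀ {p s} k → k5 j p s ≡ pathVertex k → k ≡ 0
    pathVertex-k5 zero    _ = refl
    pathVertex-k5 (suc k) eq with suc k <? b
    pathVertex-k5 (suc k) () | yes _
    pathVertex-k5 (suc k) () | no  _

    edgeBag : ℕ → List (HMV m b)
    edgeBag k = pathVertex k ∷ pathVertex (suc k) ∷ []

    edgeBag-unique : ∀ {k} → suc k ≤ b → Unique (edgeBag k)
    edgeBag-unique {k} k<b =
      ((λ eq → <-irrefl (pathVertex-injective (<⇒≤ k<b) k<b eq) (n<1+n k)) ∷ []) ∷ [] ∷ []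

    stretch : ℕ → ℕ → List (List (HMV m b))
    stretch k zero    = edgeBag k ∷ []
    stretch k (suc r) = edgeBag k ∷ (pathVertex (suc k) ∷ []) ∷ stretch (suc k) r

    pathBags : ℕ → ℕ → List (List (HMV m b))
    pathBags e zero    = []
    pathBags e (suc r) = stretch e r

    partPath : ℕ → List ℕ → List (List (HMV m b))
    partPath e []       = []
    partPath e (w ∷ ws) = pathBags e w ++ partPath (e + w) ws

    PathRange : ℕ → ℕ → HMV m b → Set
    PathRange lo hi v = ∃[ k ] (lo ≤ k × k ≤ hi × v ≡ pathVertex k)

    PathRange-weaken : ∀ {lo lo′ hi hi′ v} → lo′ ≤ lo → hi ≤ hi′ →
      PathRange lo hi v → PathRange lo′ hi′ v
    PathRange-weaken lo′≤lo hi≤hi′ (k , lo≤k , k≤hi , refl) =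
      k , ≤-trans lo′≤lo lo≤k , ≤-trans k≤hi hi≤hi′ , refl

    edgeBag-range : ∀ {v} k r → v ∈ edgeBag k → PathRange k (suc (k + r)) v
    edgeBag-range k r (here refl)         = k , ≤-refl , ≤-trans (m≤m+n k r) (n≤1+n _) , refl
    edgeBag-range k r (there (here refl)) = suc k , n≤1+n k , s≤s (m≤m+n k r) , refl

    stretch-range : ∀ {v} k r → v ∈∈ stretch k r → PathRange k (suc (k + r)) v
    stretch-range k zero    (here v∈) = edgeBag-range k zero v∈
    stretch-range k (suc r) (here v∈) = edgeBag-range k (suc r) v∈
    stretch-range k (suc r) (there (here (here refl))) = suc k , n≤1+n k , s≤s (m≤m+n k (suc r)) , refl
    stretch-range k (suc r) (there (there v∈)) =
      PathRange-weaken (n≤1+n k) (≤-reflexive (cong suc (sym (+-suc k r)))) (stretch-range (suc k) r v∈)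

    pathBags-range : ∀ {v} e w → v ∈∈ pathBags e w → PathRange e (e + w) v
    pathBags-range e (suc r) v∈ = PathRange-weaken ≤-refl (≤-reflexive (sym (+-suc e r))) (stretch-range e r v∈)

    partPath-range : ∀ {v} e ws → v ∈∈ partPath e ws → PathRange e (e + sum ws) v
    partPath-range e (w ∷ ws) v∈ with AnyP.++⁻ (pathBags e w) v∈
    ... | inj₁ v∈w  = PathRange-weaken ≤-refl (≤-trans (m≤m+n (e + w) (sum ws)) (≤-reflexive (+-assoc e w (sum ws))))
                        (pathBags-range e w v∈w)
    ... | inj₂ v∈ws = PathRange-weaken (m≤m+n e w) (≤-reflexive (+-assoc e w (sum ws)))
                        (partPath-range (e + w) ws v∈ws)

    stretch-first : ∀ k r → pathVertex k ∈ firstBag (stretch k r)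
    stretch-first k zero    = here refl
    stretch-first k (suc r) = here refl

    stretch-last : ∀ k r → pathVertex (suc (k + r)) ∈ lastBag (stretch k r)
    stretch-last k zero    = subst (λ z → pathVertex (suc z) ∈ edgeBag k) (sym (+-identityʳ k)) (there (here refl))
    stretch-last k (suc r) = lastBag-++ (edgeBag k ∷ (pathVertex (suc k) ∷ []) ∷ []) (stretch (suc k) r)
      (subst (λ z → pathVertex z ∈ lastBag (stretch (suc k) r)) (cong suc (sym (+-suc k r))) (stretch-last (suc k) r))

    interpolating-stretch : ∀ k r → suc (k + r) ≤ b → Interpolating (stretch k r)
    interpolating-stretch k zero    _   = (λ _ ()) ∷ []
    interpolating-stretch k (suc r) k+r<b =
      edge-next ∷ (λ { (here refl) _ → stretch-first (suc k) r }) ∷ interpolating-stretch (suc k) r k+r<b′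
      where
      k+r<b′ : suc (suc k + r) ≤ b
      k+r<b′ = ≤-trans (≤-reflexive (cong suc (sym (+-suc k r)))) k+r<b
      edge-next : ∀ {v} → v ∈ edgeBag k → v ∈∈ (pathVertex (suc k) ∷ []) ∷ stretch (suc k) r →
                  v ∈ pathVertex (suc k) ∷ []
      edge-next _                   (here v∈) = v∈
      edge-next (there (here refl)) (there _) = here refl
      edge-next (here refl)         (there v∈) with stretch-range (suc k) r v∈
      ... | k′ , k<k′ , k′≤ , eq = ⊥-elim (<-irrefl k≡k′ k<k′)
        where
        k≡k′ : k ≡ k′
        k≡k′ = pathVertex-injective (≤-trans (m≤m+n k (suc r)) (<⇒≤ k+r<b)) (≤-trans k′≤ k+r<b′) eq

    pathBags-last : ∀ e w → 0 < w → pathVertex (e + w) ∈ lastBag (pathBags e w)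
    pathBags-last e (suc r) _ = subst (λ z → pathVertex z ∈ lastBag (stretch e r)) (sym (+-suc e r)) (stretch-last e r)

    interpolating-pathBags : ∀ e w → e + w ≤ b → Interpolating (pathBags e w)
    interpolating-pathBags e zero    _     = []
    interpolating-pathBags e (suc r) e+w≤b = interpolating-stretch e r (≤-trans (≤-reflexive (sym (+-suc e r))) e+w≤b)

    partPath-first : ∀ {v} e ws → All (0 <_) ws → v ∈∈ partPath e ws → pathVertex e ∈ firstBag (partPath e ws)
    partPath-first e (suc r ∷ ws) _         _ = firstBag-++ (stretch e r) _ (stretch-first e r)
    partPath-first e (zero ∷ ws)  (() ∷ _)  _

    partPath-last : ∀ {v} e ws → All (0 <_) ws → v ∈∈ partPath e ws →
                    pathVertex (e + sum ws) ∈ lastBag (partPath e ws)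
    partPath-last e (w ∷ ws) pos _ = nonempty e w ws pos
      where
      nonempty : ∀ e w ws → All (0 <_) (w ∷ ws) → pathVertex (e + sum (w ∷ ws)) ∈ lastBag (partPath e (w ∷ ws))
      nonempty e w [] (0<w ∷ []) rewrite ++-identityʳ (pathBags e w) | +-identityʳ w = pathBags-last e w 0<w
      nonempty e w (w′ ∷ ws) (_ ∷ pos) = lastBag-++ (pathBags e w) _
        (subst (λ z → pathVertex z ∈ lastBag (partPath (e + w) (w′ ∷ ws))) (+-assoc e w _) (nonempty (e + w) w′ ws pos))

    interpolating-partPath : ∀ e ws → All (0 <_) ws → e + sum ws ≤ b → Interpolating (partPath e ws)
    interpolating-partPath e []       _            _  = []
    interpolating-partPath e (w ∷ ws) (0<w ∷ pos) ≤b =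
      interpolating-++ (pathBags e w) (interpolating-pathBags e w e+w≤b) (interpolating-partPath (e + w) ws pos ≤b′) shared
      where
      ≤b′ : e + w + sum ws ≤ b
      ≤b′ = ≤-trans (≤-reflexive (+-assoc e w (sum ws))) ≤b
      e+w≤b : e + w ≤ b
      e+w≤b = ≤-trans (m≤m+n (e + w) (sum ws)) ≤b′
      -- consecutive stretches share exactly their common endpoint pathVertex (e + w)
      shared : ∀ {v} → v ∈∈ pathBags e w → v ∈∈ partPath (e + w) ws →
               v ∈ lastBag (pathBags e w) × v ∈ firstBag (partPath (e + w) ws)
      shared v∈ v∈′ with pathBags-range e w v∈ | partPath-range (e + w) ws v∈′
      ... | k , _ , k≤ , refl | k′ , k≥ , k′≤ , eq
        with pathVertex-injective (≤-trans k≤ e+w≤b) (≤-trans k′≤ ≤b′) eq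
      ... | refl rewrite ≤-antisym k≤ k≥ = pathBags-last e w 0<w , partPath-first (e + w) ws pos v∈′

    EdgeIn : ℕ → List (HMV m b) → Set
    EdgeIn e B = pathVertex e ∈ B × pathVertex (suc e) ∈ B

    stretch-edge : ∀ {e} k r → k ≤ e → e < k + suc r → Any (EdgeIn e) (stretch k r)
    stretch-edge k zero k≤e e< with range-step k≤e e<
    ... | inj₁ refl         = here (here refl , there (here refl))
    ... | inj₂ (k<e , e<′)  = ⊥-elim (range-empty k<e e<′)
    stretch-edge k (suc r) k≤e e< with range-step k≤e e<
    ... | inj₁ refl         = here (here refl , there (here refl))
    ... | inj₂ (k<e , e<′)  = there (there (stretch-edge (suc k) r k<e e<′))

    pathBags-edge : ∀ {e} e₀ w → e₀ ≤ e → e < e₀ + w → Any (EdgeIn e) (pathBags e₀ w)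
    pathBags-edge e₀ zero    e₀≤e e< = ⊥-elim (range-empty e₀≤e e<)
    pathBags-edge e₀ (suc r) e₀≤e e< = stretch-edge e₀ r e₀≤e e<

    partPath-edge : ∀ {e} e₀ ws → e₀ ≤ e → e < e₀ + sum ws → Any (EdgeIn e) (partPath e₀ ws)
    partPath-edge e₀ []       e₀≤e e< = ⊥-elim (range-empty e₀≤e e<)
    partPath-edge {e} e₀ (w ∷ ws) e₀≤e e< with e <? e₀ + w
    ... | yes e<′ = AnyP.++⁺ˡ (pathBags-edge e₀ w e₀≤e e<′)
    ... | no  e≮  = AnyP.++⁺ʳ (pathBags e₀ w)
                      (partPath-edge (e₀ + w) ws (≮⇒≥ e≮) (subst (e <_) (sym (+-assoc e₀ w (sum ws))) e<))

    length-stretch : ∀ k r → length (stretch k r) ≡ suc (r + r)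
    length-stretch k zero    = refl
    length-stretch k (suc r) = cong (λ n → suc (suc n)) (trans (length-stretch (suc k) r) (sym (+-suc r r)))

    length-partPath : ∀ e ws → length (partPath e ws) ≡ sum (map (λ w → w + pred w) ws)
    length-partPath e []            = refl
    length-partPath e (zero  ∷ ws)  = length-partPath (e + 0) ws
    length-partPath e (suc r ∷ ws)  =
      trans (length-++ (stretch e r)) (cong₂ _+_ (length-stretch e r) (length-partPath (e + suc r) ws))

module _ {m b : ℕ} (j : ℕ) (j<m : j < m) where

  chainFrom-stretch : ∀ {w} q r (eq : q + suc r ≡ w) k → suc (k + r) ≤ b →
    Pointwise (Fits 5) (chainFrom q r eq) (stretch {m} {b} j j<m k r)
  chainFrom-stretch q zero eq k k<b =
    (triangleBag-unique q _ , edgeBag-unique j j<m (subst (_≤ b) (cong suc (+-identityʳ k)) k<b) , ≤-refl) ∷ []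
  chainFrom-stretch q (suc r) eq k k+r<b =
    (triangleBag-unique q _ , edgeBag-unique j j<m (≤-trans (s≤s (m≤m+n k (suc r))) k+r<b) , ≤-refl) ∷
    (k4Bag-unique q _ _ , [] ∷ [] , ≤-refl) ∷
    chainFrom-stretch (suc q) r _ (suc k) (≤-trans (≤-reflexive (cong suc (sym (+-suc k r)))) k+r<b)

  chain-pathBags : ∀ w e → e + w ≤ b → Pointwise (Fits 5) (chain w) (pathBags {m} {b} j j<m e w)
  chain-pathBags zero    e _     = []
  chain-pathBags (suc r) e e+w≤b = chainFrom-stretch 0 r refl e (≤-trans (≤-reflexive (sym (+-suc e r))) e+w≤b)

module Construction (m : ℕ) (S : Fin (3 * m) → ℕ) (b : ℕ) (f : Fin (3 * m) → Fin m)
                    (pos : ∀ i → 0 < S i) (balanced : ∀ J → partSum m S f J ≡ b) where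

  VH : Set
  VH = Σ (Fin (3 * m)) (λ i → HV (S i))

  VHmb : Set
  VHmb = HMV m b

  members : Fin m → List (Fin (3 * m))
  members J = filter (λ i → f i Fin.≟ J) (allFin (3 * m))

  members-unique : ∀ J → Unique (members J)
  members-unique J = Unique.filter⁺ (λ i → f i Fin.≟ J) (Unique.allFin⁺ (3 * m))

  ∈-members⁻ : ∀ {i J} → i ∈ members J → f i ≡ J
  ∈-members⁻ {J = J} i∈ = proj₂ (∈-filter⁻ (λ i → f i Fin.≟ J) {xs = allFin (3 * m)} i∈)

  ∈-members⁺ : ∀ i → i ∈ members (f i)
  ∈-members⁺ i = ∈-filter⁺ (λ i′ → f i′ Fin.≟ f i) (∈-allFin i) refl

  weights : Fin m → List ℕ
  weights J = map S (members J)

  weights-positive : ∀ is → All (0 <_) (map S is)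
  weights-positive is = All.map⁺ (All.tabulate (λ {i} _ → pos i))

  partChains : Fin m → List (List VH)
  partChains J = concatMap (λ i → tagged i (chain (S i))) (members J)

  partChains-part : ∀ {J x} → x ∈∈ partChains J → f (proj₁ x) ≡ J
  partChains-part x∈ = ∈-members⁻ (∈∈-concat-tagged (λ i → chain (S i)) x∈)

  interpolating-partChains : ∀ J → Interpolating (partChains J)
  interpolating-partChains J =
    interpolating-concat-tagged (λ i → chain (S i)) (λ i → interpolating-chain (S i)) (members-unique J)

  -- The empty bag in front of each part is paired with the bag of K5^j.
  chainBlocks : (j r : ℕ) → j + r ≡ m → List (List VH)
  chainBlocks j zero    _  = [] ∷ []
  chainBlocks j (suc r) eq = [] ∷ (partChains (fromℕ< (+suc⇒< eq)) ++ chainBlocks (suc j) r (+suc-shift eq))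

  chainBlocks-part : ∀ {x} j r eq → x ∈∈ chainBlocks j r eq → j ≤ toℕ (f (proj₁ x))
  chainBlocks-part j zero    eq (here ())
  chainBlocks-part j zero    eq (there ())
  chainBlocks-part j (suc r) eq (here ())
  chainBlocks-part j (suc r) eq (there x∈) with AnyP.++⁻ (partChains (fromℕ< (+suc⇒< eq))) x∈
  ... | inj₁ x∈J    = ≤-reflexive (sym (trans (cong toℕ (partChains-part x∈J)) (Fin.toℕ-fromℕ< _)))
  ... | inj₂ x∈rest = ≤-trans (n≤1+n j) (chainBlocks-part (suc j) r _ x∈rest)

  interpolating-chainBlocks : ∀ j r eq → Interpolating (chainBlocks j r eq)
  interpolating-chainBlocks j zero    eq = (λ ()) ∷ []
  interpolating-chainBlocks j (suc r) eq =
    (λ ()) ∷ interpolating-++-disjoint (partChains J) (interpolating-partChains J)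
               (interpolating-chainBlocks (suc j) r _)
               (λ x∈J x∈rest → <-irrefl (sym (trans (cong toℕ (partChains-part x∈J)) (Fin.toℕ-fromℕ< _)))
                                        (chainBlocks-part (suc j) r _ x∈rest))
    where
    J : Fin m
    J = fromℕ< (+suc⇒< eq)

  chainBlocks-any : ∀ {P : VH → Set} J j r eq → j ≤ toℕ J → toℕ J < j + r →
    Any (P ⊆ₚ_) (partChains J) → Any (P ⊆ₚ_) (chainBlocks j r eq)
  chainBlocks-any J j zero    eq j≤J J< _ = ⊥-elim (range-empty j≤J J<)
  chainBlocks-any J j (suc r) eq j≤J J< p with range-step j≤J J<
  ... | inj₁ refl       = there (AnyP.++⁺ˡ (subst (λ J′ → Any _ (partChains J′)) (sym (Fin.fromℕ<-toℕ J _)) p))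
  ... | inj₂ (j<J , J<′) = there (AnyP.++⁺ʳ (partChains _) (chainBlocks-any J (suc j) r _ j<J J<′ p))

  partBags : ∀ j → j < m → List (List VHmb)
  partBags j j<m = partPath j j<m 0 (weights (fromℕ< j<m))

  pathBlocks : (j r : ℕ) → j + r ≡ m → List (List VHmb)
  pathBlocks j zero    eq = k5Bag j (≤-reflexive (trans (sym (+-identityʳ j)) eq)) ∷ []
  pathBlocks j (suc r) eq = k5Bag j (<⇒≤ (+suc⇒< eq)) ∷ (partBags j (+suc⇒< eq) ++ pathBlocks (suc j) r (+suc-shift eq))

  pathBlocks-block : ∀ {v} j r eq → v ∈∈ pathBlocks j r eq → j ≤ block v
  pathBlocks-block j zero    eq (here v∈) = ≤-reflexive (sym (k5Bag-block v∈))
  pathBlocks-block j (suc r) eq (here v∈) = ≤-reflexive (sym (k5Bag-block v∈))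
  pathBlocks-block j (suc r) eq (there v∈) with AnyP.++⁻ (partBags j (+suc⇒< eq)) v∈
  ... | inj₁ v∈J with partPath-range j (+suc⇒< eq) 0 (weights _) v∈J
  ...   | k , _ , _ , refl = pathVertex-block j _ k
  pathBlocks-block j (suc r) eq (there v∈) | inj₂ v∈rest = ≤-trans (n≤1+n j) (pathBlocks-block (suc j) r _ v∈rest)

  k5-∈-firstBag-pathBlocks : ∀ {v} j r eq → (∀ {p} → v ∈ k5Bag j p) → v ∈ firstBag (pathBlocks j r eq)
  k5-∈-firstBag-pathBlocks j zero    eq v∈ = v∈
  k5-∈-firstBag-pathBlocks j (suc r) eq v∈ = v∈

  interpolating-pathBlocks : ∀ j r eq → Interpolating (pathBlocks j r eq)
  interpolating-pathBlocks j zero    eq = (λ _ ()) ∷ []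
  interpolating-pathBlocks j (suc r) eq =
    k5-next ∷ interpolating-++ P (interpolating-partPath j j<m 0 ws (weights-positive _) (≤-reflexive (balanced J)))
                                 (interpolating-pathBlocks (suc j) r _) shared
    where
    j<m : j < m
    j<m = +suc⇒< eq
    J : Fin m
    J = fromℕ< j<m
    ws : List ℕ
    ws = weights J
    P rest : List (List VHmb)
    P = partBags j j<m
    rest = pathBlocks (suc j) r (+suc-shift eq)

    -- K5^j meets P^j only in the first vertex of the path.
    k5-next : ∀ {v} → v ∈ k5Bag j (<⇒≤ j<m) → v ∈∈ P ++ rest → v ∈ firstBag (P ++ rest)
    k5-next v∈ v∈′ with AnyP.++⁻ P v∈′
    ... | inj₂ v∈rest = ⊥-elim (<-irrefl (sym (k5Bag-block v∈)) (pathBlocks-block (suc j) r _ v∈rest))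
    ... | inj₁ v∈P with partPath-range j j<m 0 ws v∈P | ∈-map⁻ (k5 j (<⇒≤ j<m)) v∈
    ...   | k , _ , _ , refl | _ , _ , k5≡ with pathVertex-k5 j j<m k (sym k5≡)
    ...     | refl = firstBag-++ P rest (partPath-first j j<m 0 ws (weights-positive _) v∈P)

    shared : ∀ {v} → v ∈∈ P → v ∈∈ rest → v ∈ lastBag P × v ∈ firstBag rest
    shared v∈P v∈rest with partPath-range j j<m 0 ws v∈P
    ... | k , _ , k≤ , refl
      with pathVertex-beyond j j<m k (≤-trans k≤ (≤-reflexive (balanced J))) (pathBlocks-block (suc j) r _ v∈rest)
    ...   | refl , v∈K5 =
      subst (λ z → pathVertex j j<m z ∈ lastBag P) (balanced J) (partPath-last j j<m 0 ws (weights-positive _) v∈P) ,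
      k5-∈-firstBag-pathBlocks (suc j) r _ v∈K5

  pathBlocks-k5 : ∀ {j′ p} j r eq → j ≤ j′ → j′ < j + suc r → Any (HMIn (K5 j′ p) ⊆ₚ_) (pathBlocks j r eq)
  pathBlocks-k5 j zero eq j≤j′ j′< with range-step j≤j′ j′<
  ... | inj₁ refl          = here λ { inK5 → k5-∈-k5Bag }
  ... | inj₂ (j<j′ , j′<′) = ⊥-elim (range-empty j<j′ j′<′)
  pathBlocks-k5 j (suc r) eq j≤j′ j′< with range-step j≤j′ j′<
  ... | inj₁ refl          = here λ { inK5 → k5-∈-k5Bag }
  ... | inj₂ (j<j′ , j′<′) = there (AnyP.++⁺ʳ (partBags j _) (pathBlocks-k5 (suc j) r _ j<j′ j′<′))

  pathBlocks-any : ∀ {P : VHmb → Set} j′ → (∀ j′<m → Any (P ⊆ₚ_) (partBags j′ j′<m)) →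
    ∀ j r eq → j ≤ j′ → j′ < j + r → Any (P ⊆ₚ_) (pathBlocks j r eq)
  pathBlocks-any j′ p j zero    eq j≤j′ j′< = ⊥-elim (range-empty j≤j′ j′<)
  pathBlocks-any j′ p j (suc r) eq j≤j′ j′< with range-step j≤j′ j′<
  ... | inj₁ refl          = there (AnyP.++⁺ˡ (p _))
  ... | inj₂ (j<j′ , j′<′) = there (AnyP.++⁺ʳ (partBags j _) (pathBlocks-any j′ p (suc j) r _ j<j′ j′<′))

  partBags-segment : ∀ {j p e q} j<m → Any (HMIn (seg j p e q) ⊆ₚ_) (partBags j j<m)
  partBags-segment {j} {p} {e} {q} j<m =
    Any.map segment-in (partPath-edge j j<m 0 (weights _) z≤n (subst (e <_) (sym (balanced _)) q))
    where
    0<b : 0 < b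
    0<b = ≤-trans (s≤s z≤n) q
    segment-in : ∀ {B} → EdgeIn j j<m e B → HMIn (seg j p e q) ⊆ₚ B
    segment-in (e∈ , _)  (segL v∈) = subst (_∈ _) (sym (PathVx⇒pathVertex j j<m 0<b v∈)) e∈
    segment-in (_ , e+1∈) (segR v∈) = subst (_∈ _) (sym (PathVx⇒pathVertex j j<m 0<b v∈)) e+1∈

  Xs : List (List VH)
  Xs = chainBlocks 0 m refl

  Ys : List (List VHmb)
  Ys = pathBlocks 0 m refl

  chainBlocks-contains : ∀ i (c : HC (S i)) → Any ((λ x → ∃[ y ] (x ≡ (i , y) × HIn c y)) ⊆ₚ_) Xs
  chainBlocks-contains i c = chainBlocks-any (f i) 0 m refl z≤n (Fin.toℕ<n (f i))
    (AnyP.concatMap⁺ (λ i → tagged i (chain (S i)))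
      (Any.map (λ { refl → any-tagged (chain-contains c) }) (∈-members⁺ i)))

  pathBlocks-contains : ∀ c → Any (HMIn c ⊆ₚ_) Ys
  pathBlocks-contains (K5 j p)       = pathBlocks-k5 0 m refl z≤n (s≤s p)
  pathBlocks-contains (seg j p e q)  = pathBlocks-any j partBags-segment 0 m refl z≤n p

  fits-part : ∀ j (j<m : j < m) is e → e + sum (map S is) ≤ b →
    Pointwise (Fits 5) (concatMap (λ i → tagged i (chain (S i))) is) (partPath {b = b} j j<m e (map S is))
  fits-part j j<m []       e _  = []
  fits-part j j<m (i ∷ is) e ≤b =
    Pointwise.++⁺ (fits-map (λ { refl → refl }) (chain-pathBags {b = b} j j<m (S i) e e+w≤b))
                  (fits-part j j<m is (e + S i) ≤b′)
    where
    ≤b′ : e + S i + sum (map S is) ≤ b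
    ≤b′ = ≤-trans (≤-reflexive (+-assoc e (S i) _)) ≤b
    e+w≤b : e + S i ≤ b
    e+w≤b = ≤-trans (m≤m+n (e + S i) _) ≤b′

  fits-blocks : ∀ j r eq → Pointwise (Fits 5) (chainBlocks j r eq) (pathBlocks j r eq)
  fits-blocks j zero    eq = ([] , k5Bag-unique j _ , ≤-refl) ∷ []
  fits-blocks j (suc r) eq = ([] , k5Bag-unique j _ , ≤-refl)
    ∷ Pointwise.++⁺ (fits-part j _ (members _) 0 (≤-reflexive (balanced _))) (fits-blocks (suc j) r _)

  itemLength : Fin (3 * m) → ℕ
  itemLength i = S i + pred (S i)

  length-pathBlocks : ∀ j r eq → length (pathBlocks j r eq) ≡ suc r + sumFrom (fibreSum f itemLength (allFin (3 * m))) j r eq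
  length-pathBlocks j zero    eq = refl
  length-pathBlocks j (suc r) eq = cong suc (begin
    length (P ++ rest)                       ≡⟨ length-++ P ⟩
    length P + length rest                   ≡⟨ cong₂ _+_ length-P (length-pathBlocks (suc j) r _) ⟩
    A + (suc r + B)                          ≡⟨ x∙yz≈y∙xz A (suc r) B ⟩
    suc r + (A + B)                          ∎)
    where
    open ≡-Reasoning
    J : Fin m
    J = fromℕ< (+suc⇒< eq)
    P rest : List (List VHmb)
    P = partBags j (+suc⇒< eq)
    rest = pathBlocks (suc j) r (+suc-shift eq)
    A B : ℕ
    A = fibreSum f itemLength (allFin (3 * m)) J
    B = sumFrom (fibreSum f itemLength (allFin (3 * m))) (suc j) r (+suc-shift eq)
    length-P : length P ≡ A
    length-P = trans (length-partPath j _ 0 (weights J)) (cong sum (sym (map-∘ (members J))))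

  sum-itemLength : ∀ is → sum (map itemLength is) + length is ≡ sum (map S is) + sum (map S is)
  sum-itemLength []       = refl
  sum-itemLength (i ∷ is) = begin
    (itemLength i + sum (map itemLength is)) + (1 + length is) ≡⟨ interchange (itemLength i) _ 1 _ ⟩
    (itemLength i + 1) + (sum (map itemLength is) + length is) ≡⟨ cong₂ _+_ (item (S i) (pos i)) (sum-itemLength is) ⟩
    (S i + S i) + (sum (map S is) + sum (map S is))             ≡⟨ interchange (S i) (S i) _ _ ⟩
    (S i + sum (map S is)) + (S i + sum (map S is))             ∎
    where
    open ≡-Reasoning
    item : ∀ w → 0 < w → (w + pred w) + 1 ≡ w + w
    item (suc r) _ = trans (+-comm (suc r + r) 1) (cong suc (sym (+-suc r r)))

  length-Ys : length Ys + 2 * m ≡ 1 + 2 * totalWeight m S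
  length-Ys = begin
    length Ys + 2 * m
      ≡⟨ cong (_+ 2 * m) (length-pathBlocks 0 m refl) ⟩
    suc m + sumFrom (fibreSum f itemLength all) 0 m refl + 2 * m
      ≡⟨ cong (λ n → suc m + n + 2 * m) (sumFrom-fibreSum f itemLength all) ⟩
    suc (m + Σℓ + 2 * m)
      ≡⟨ cong (λ n → suc (n + 2 * m)) (+-comm m Σℓ) ⟩
    suc (Σℓ + m + 2 * m)
      ≡⟨ cong suc (+-assoc Σℓ m (2 * m)) ⟩
    suc (Σℓ + 3 * m)
      ≡⟨ cong (λ n → suc (Σℓ + n)) (sym (length-tabulate {n = 3 * m} id)) ⟩
    suc (Σℓ + length all)
      ≡⟨ cong suc (sum-itemLength all) ⟩
    suc (W + W)
      ≡⟨ cong (λ n → suc (W + n)) (sym (+-identityʳ W)) ⟩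
    1 + 2 * W ∎
    where
    open ≡-Reasoning
    all : List (Fin (3 * m))
    all = allFin (3 * m)
    Σℓ W : ℕ
    Σℓ = sum (map itemLength all)
    W = totalWeight m S

  home : ∀ v → ∃[ c ] GIn {m} {S} {b} c v
  home (inj₁ (i , tri q p t))     = inj₁ (i , T q p) , inH inT
  home (inj₁ (i , k4 q p s))      = inj₁ (i , K q p) , inH inK-own
  home (inj₂ (k5 j p s))          = inj₂ (K5 j p) , inHM inK5
  home (inj₂ (pint j p k k+1<b))  = inj₂ (seg j p k (≤-trans (n≤1+n _) k+1<b)) , inHM (segR mid)

  L : List (List (GV m S b))
  L = zipWith _⊎ᵇ_ Xs Ys

  contained : ∀ c → Any (GIn c ⊆ₚ_) L
  contained (inj₁ (i , c)) = Any.map (λ X⊆ → λ { (inH y∈c) → X⊆ (_ , refl , y∈c) })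
                                     (any-zip-inj₁ (fits-blocks 0 m refl) (chainBlocks-contains i c))
  contained (inj₂ c)       = Any.map (λ Y⊆ → λ { (inHM v∈c) → Y⊆ v∈c })
                                     (any-zip-inj₂ (fits-blocks 0 m refl) (pathBlocks-contains c))

  decomposition : Σ (PathDecomposition (G m S b) (length L)) (λ P → WidthAtMost P 4)
  decomposition = cliqueDecomposition GIn 4 L
    (interpolating-zip (fits-blocks 0 m refl) (interpolating-chainBlocks 0 m refl) (interpolating-pathBlocks 0 m refl))
    (all-zip (fits-blocks 0 m refl)) home contained

  length-L : length L + 2 * m ≡ 1 + 2 * totalWeight m S
  length-L = trans (cong (_+ 2 * m) (length-zip (fits-blocks 0 m refl))) length-Ys

lemma4 : (m : ℕ) (S : Fin (3 * m) → ℕ) (b : ℕ) →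
    (∀ i → 0 < S i) →
    (∃[ f ] (∀ j → partSum m S f j ≡ b)) →
    ∃[ l ] (l + 2 * m ≤ 1 + 2 * totalWeight m S ×
    Σ (PathDecomposition (G m S b) l) (λ P → WidthAtMost P 4))
lemma4 m S b pos (f , balanced) = length L , ≤-reflexive length-L , decomposition
  where open Construction m S b f pos balanced
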